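{- The following semigroups have matricial dimension $2$: (a) the cyclic semigroups $\langle a\rangle = \{0, a, 2a, 3a, \ldots\}$ with $a \geq 2$; (b) the ordinary semigroups $S_b = \{0\} \cup \{b,b+1,b+2,\ldots\}$ with $b \geq 2$; (c) the semigroups $\langle a\rangle \cup S_b$ with $a,b\geq 2$.
   Context: $\mathbb{N} = \{0,1,2,\ldots\}$. A semigroup here means an additive subsemigroup of $\mathbb{N}$ containing $0$. $\mathsf{M}_d(X)$ denotes the set of $d\times d$ matrices with entries in $X$. For $A \in \mathsf{M}_d(\mathbb{Q})$, $\mathcal{S}(A) = \{ n \in \mathbb{N} : A^n \in \mathsf{M}_d(\mathbb{Z})\}$. The matricial dimension of a semigroup $S$ is the smallest $d$ such that $S = \mathcal{S}(A)$ for some $A \in \mathsf{M}_d(\mathbb{Q})$. -}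

module Defs where

open import Data.Nat as ℕ using (ℕ; zero; suc; _≤_; _<_)
open import Data.Integer using (ℤ)
open import Data.Rational as ℚ using (ℚ; 0ℚ; 1ℚ; _/_)
open import Data.Fin using (Fin; zero; suc; _≟_)
open import Data.Product using (Σ; ∃; ∃-syntax; _×_)
open import Data.Sum using (_⊎_)
open import Relation.Nullary using (¬_; yes; no)
open import Relation.Binary.PropositionalEquality using (_≡_)
open import Function.Bundles using (_⇔_)

M : ℕ → Set → Set
M d X = Fin d → Fin d → X

Σℚ : (d : ℕ) → (Fin d → ℚ) → ℚ
Σℚ zero    f = 0ℚ
Σℚ (suc d) f = f zero ℚ.+ Σℚ d (λ i → f (suc i))

_⊗_ : ∀ {d} → M d ℚ → M d ℚ → M d ℚ
_⊗_ {d} A B i j = Σℚ d (λ k → A i k ℚ.* B k j)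

I : ∀ {d} → M d ℚ
I i j with i ≟ j
... | yes _ = 1ℚ
... | no  _ = 0ℚ

_^_ : ∀ {d} → M d ℚ → ℕ → M d ℚ
A ^ zero  = I
A ^ suc n = A ⊗ (A ^ n)

IsInt : ℚ → Set
IsInt q = ∃[ z ] q ≡ z / 1

IntegralMatrix : ∀ {d} → M d ℚ → Set
IntegralMatrix A = ∀ i j → IsInt (A i j)

𝒮 : ∀ {d} → M d ℚ → ℕ → Set
𝒮 A n = IntegralMatrix (A ^ n)

Realizable : (ℕ → Set) → ℕ → Set
Realizable S d = ∃[ A ] (∀ n → S n ⇔ 𝒮 {d} A n)

MatDim : (ℕ → Set) → ℕ → Set
MatDim S d = Realizable S d × (∀ d′ → d′ < d → ¬ Realizable S d′)

Cyclic : ℕ → ℕ → Set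
Cyclic a n = ∃[ k ] n ≡ k ℕ.* a

Ordinary : ℕ → ℕ → Set
Ordinary b n = n ≡ 0 ⊎ b ≤ n

_∪_ : (ℕ → Set) → (ℕ → Set) → ℕ → Set
(S ∪ T) n = S n ⊎ T n

-- A 2 × 2 matrix T = [[X, U/m], [0, C]] with X, U, C ∈ ℕ has T^n = [[X^n, N n / m], [0, C^n]],
-- where N (n + 1) = X · N n + U · C^n; so 𝒮(T) = {n : m ∣ N n}.  For ⟨a⟩ take X = U = C = 1, m = a.
-- For ⟨a⟩ ∪ S_b let Q = 1 + a + ⋯ + a^(a-1), so that a^a ≡ 1 (mod Q) and Q ≡ 1 (mod a), put
-- y = a^(Q^(b-2)) and take X = Q y, U = y - 1, C = Q, m = Q^(b-1); then N n = Q^(n-1) (y^n - 1).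
-- Lifting the exponent gives y^a ≡ 1 (mod Q^(b-1)), while y ≡ a (mod Q) and a^r < Q for r < a show
-- that Q ∣ y^n - 1 only if a ∣ n.  Hence m ∣ N n iff n = 0, a ∣ n or b ≤ n.  S_b is ⟨b⟩ ∪ S_b.
-- No smaller dimension works, as none of these semigroups contains 1: every n lies in 𝒮 of a 0 × 0
-- matrix, and if q^(n+1) is an integer for a rational q, then so is q.

module Submission where

open import Data.Nat as ℕ
  using (ℕ; zero; suc; NonZero; _+_; _*_; _^_; _∸_; _≤_; _<_; z<s; s≤s; _%_; _≤?_)
open import Data.Nat.Properties
open import Data.Nat.Divisibility
  using (_∣_; divides; m∣m*n; ∣m+n∣m⇒∣n; ∣-refl; ∣-trans; _∣0; ∣1⇒≡1; m%n≡0⇒n∣m)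
open import Data.Nat.DivMod using (m≡m%n+[m/n]*n; [m+kn]%n≡m%n; m<n⇒m%n≡m; m%n<n)
open import Data.Nat.Coprimality as Coprime using (Coprime; coprime-divisor)
open import Data.Nat.Tactic.RingSolver using (solve-∀)
open import Data.Integer as ℤ using (+_)
import Data.Integer.Properties as ℤ
open import Data.Rational as ℚ using (ℚ; _/_; 0ℚ; 1ℚ; toℚᵘ; fromℚᵘ)
import Data.Rational.Properties as ℚ
open import Data.Rational.Solver using (module +-*-Solver)
open import Data.Rational.Unnormalised as ℚᵘ using (ℚᵘ; mkℚᵘ; *≡*)
import Data.Rational.Unnormalised.Properties as ℚᵘ
open import Data.Fin using (Fin; zero; suc)
open import Data.Product using (_×_; _,_)
open import Data.Sum using (inj₁; inj₂; [_,_]′)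
open import Function.Bundles using (_⇔_; mk⇔; Equivalence)
import Function.Properties.Equivalence as ⇔
open import Relation.Nullary using (¬_; yes; no)
open import Relation.Binary.PropositionalEquality

open import Defs renaming (_^_ to _^ᴹ_)

-- One-sided congruence: the quotient (x - r) / m is a natural number, so r ≤ x.
infix 4 _≡_mod_
record _≡_mod_ (x r m : ℕ) : Set where
  constructor ≡mod
  field
    quotient : ℕ
    equality : x ≡ r + m * quotient

≡-mod-refl : ∀ {x m} → x ≡ x mod m
≡-mod-refl {x} {m} = ≡mod 0 (sym (trans (cong (_+_ x) (*-zeroʳ m)) (+-identityʳ x)))

≡-mod-trans : ∀ {x y z m} → x ≡ y mod m → y ≡ z mod m → x ≡ z mod m
≡-mod-trans {z = z} {m} (≡mod k refl) (≡mod l refl) =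
  ≡mod (l + k) (trans (+-assoc z (m * l) (m * k)) (cong (_+_ z) (sym (*-distribˡ-+ m l k))))

≡-mod-+ : ∀ {x y r s m} → x ≡ r mod m → y ≡ s mod m → x + y ≡ r + s mod m
≡-mod-+ {r = r} {s} {m} (≡mod k refl) (≡mod l refl) = ≡mod (k + l) (lemma r s m k l)
  where
  lemma : ∀ r s m k l → r + m * k + (s + m * l) ≡ r + s + m * (k + l)
  lemma = solve-∀

≡-mod-* : ∀ {x y r s m} → x ≡ r mod m → y ≡ s mod m → x * y ≡ r * s mod m
≡-mod-* {r = r} {s} {m} (≡mod k refl) (≡mod l refl) = ≡mod (k * s + r * l + m * k * l) (lemma r s m k l)
  where
  lemma : ∀ r s m k l → (r + m * k) * (s + m * l) ≡ r * s + m * (k * s + r * l + m * k * l)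
  lemma = solve-∀

≡-mod-^ : ∀ {x r m} → x ≡ r mod m → ∀ n → x ^ n ≡ r ^ n mod m
≡-mod-^ x≡r zero    = ≡-mod-refl
≡-mod-^ x≡r (suc n) = ≡-mod-* x≡r (≡-mod-^ x≡r n)

≡1-mod-^ : ∀ {x m} → x ≡ 1 mod m → ∀ n → x ^ n ≡ 1 mod m
≡1-mod-^ {x} {m} x≡1 n = subst (λ r → x ^ n ≡ r mod m) (^-zeroˡ n) (≡-mod-^ x≡1 n)

≡-mod⇒%≡ : ∀ {x r m} .{{_ : NonZero m}} → x ≡ r mod m → x % m ≡ r % m
≡-mod⇒%≡ {r = r} {m} (≡mod k refl) = trans (cong (λ t → (r + t) % m) (*-comm m k)) ([m+kn]%n≡m%n r k m)

≡-mod-unique : ∀ {x r s m} → x ≡ r mod m → x ≡ s mod m → r < m → s < m → r ≡ s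
≡-mod-unique {x} {r} {s} {m@(suc _)} x≡r x≡s r<m s<m = begin
  r      ≡⟨ m<n⇒m%n≡m r<m ⟨
  r % m  ≡⟨ ≡-mod⇒%≡ x≡r ⟨
  x % m  ≡⟨ ≡-mod⇒%≡ x≡s ⟩
  s % m  ≡⟨ m<n⇒m%n≡m s<m ⟩
  s      ∎
  where open ≡-Reasoning

^≡^% : ∀ {x d m} .{{_ : NonZero d}} → x ^ d ≡ 1 mod m → ∀ n → x ^ n ≡ x ^ (n % d) mod m
^≡^% {x} {d} {m} xᵈ≡1 n =
  subst₂ (λ u v → u ≡ v mod m) (sym xⁿ≡xʳ*[xᵈ]^q) (*-identityʳ (x ^ r))
    (≡-mod-* (≡-mod-refl {x ^ r}) (≡1-mod-^ xᵈ≡1 q))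
  where
  open ≡-Reasoning
  r q : ℕ
  r = n % d
  q = n ℕ./ d
  xⁿ≡xʳ*[xᵈ]^q : x ^ n ≡ x ^ r * (x ^ d) ^ q
  xⁿ≡xʳ*[xᵈ]^q = begin
    x ^ n                  ≡⟨ cong (x ^_) (m≡m%n+[m/n]*n n d) ⟩
    x ^ (r + q * d)        ≡⟨ ^-distribˡ-+-* x r (q * d) ⟩
    x ^ r * x ^ (q * d)    ≡⟨ cong (λ e → x ^ r * x ^ e) (*-comm q d) ⟩
    x ^ r * x ^ (d * q)    ≡⟨ cong (x ^ r *_) (^-*-assoc x d q) ⟨
    x ^ r * (x ^ d) ^ q    ∎

^-monoʳ-∣ : ∀ m {i j} → i ≤ j → m ^ i ∣ m ^ j
^-monoʳ-∣ m {i} {j} i≤j = subst (m ^ i ∣_) mⁱ*mʲ⁻ⁱ≡mʲ (m∣m*n (m ^ (j ∸ i)))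
  where
  mⁱ*mʲ⁻ⁱ≡mʲ : m ^ i * m ^ (j ∸ i) ≡ m ^ j
  mⁱ*mʲ⁻ⁱ≡mʲ = trans (sym (^-distribˡ-+-* m i (j ∸ i))) (cong (m ^_) (m+[n∸m]≡n i≤j))

repunit : ℕ → ℕ → ℕ
repunit x zero    = 0
repunit x (suc n) = 1 + x * repunit x n

^≡1+*repunit : ∀ x n → suc x ^ n ≡ 1 + x * repunit (suc x) n
^≡1+*repunit x zero    = sym (cong suc (*-zeroʳ x))
^≡1+*repunit x (suc n) = trans (cong (suc x *_) (^≡1+*repunit x n)) (lemma x (repunit (suc x) n))
  where
  lemma : ∀ x R → suc x * (1 + x * R) ≡ 1 + x * (1 + suc x * R)
  lemma = solve-∀

^≤repunit : ∀ x n → x ^ n ≤ repunit x (suc n)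
^≤repunit x zero    = ≤-reflexive (cong suc (sym (*-zeroʳ x)))
^≤repunit x (suc n) = m≤n⇒m≤1+n (*-monoʳ-≤ x (^≤repunit x n))

repunit-≡ : ∀ {x m} → x ≡ 1 mod m → ∀ n → repunit x n ≡ n mod m
repunit-≡ x≡1 zero    = ≡-mod-refl
repunit-≡ {x} {m} x≡1 (suc n) =
  subst (λ k → repunit x (suc n) ≡ suc k mod m) (*-identityˡ n)
    (≡-mod-+ {1} ≡-mod-refl (≡-mod-* x≡1 (repunit-≡ x≡1 n)))

lift-≡1 : ∀ {q m x} → q ∣ m → x ≡ 1 mod m → x ^ q ≡ 1 mod q * m
lift-≡1 {q} (divides e refl) (≡mod t refl) = ≡mod (t * suc s) (begin
  suc (e * q * t) ^ q                          ≡⟨ ^≡1+*repunit (e * q * t) q ⟩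
  1 + e * q * t * repunit (suc (e * q * t)) q  ≡⟨ cong (λ R → 1 + e * q * t * R) repunit≡q+qs ⟩
  1 + e * q * t * (q + q * s)                  ≡⟨ lemma e q t s ⟩
  1 + q * (e * q) * (t * suc s)                ∎)
  where
  open ≡-Reasoning
  x≡1-mod-q : suc (e * q * t) ≡ 1 mod q
  x≡1-mod-q = ≡mod (e * t) (cong suc (trans (cong (_* t) (*-comm e q)) (*-assoc q e t)))
  open _≡_mod_ (repunit-≡ x≡1-mod-q q) renaming (quotient to s; equality to repunit≡q+qs)
  lemma : ∀ e q t s → 1 + e * q * t * (q + q * s) ≡ 1 + q * (e * q) * (t * (1 + s))
  lemma = solve-∀

lift-≡1-^ : ∀ {q x} → x ≡ 1 mod q → ∀ j → x ^ (q ^ j) ≡ 1 mod q ^ suc j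
lift-≡1-^ {q} {x} x≡1 zero =
  subst₂ (λ u v → u ≡ 1 mod v) (sym (^-identityʳ x)) (sym (*-identityʳ q)) x≡1
lift-≡1-^ {q} {x} x≡1 (suc j) =
  subst (λ u → u ≡ 1 mod q ^ suc (suc j)) [xᵠʲ]ᵠ≡xᵠʲ⁺¹ (lift-≡1 {q} (m∣m*n (q ^ j)) (lift-≡1-^ x≡1 j))
  where
  [xᵠʲ]ᵠ≡xᵠʲ⁺¹ : (x ^ (q ^ j)) ^ q ≡ x ^ (q ^ suc j)
  [xᵠʲ]ᵠ≡xᵠʲ⁺¹ = trans (^-*-assoc x (q ^ j) q) (cong (x ^_) (*-comm (q ^ j) q))

fromℚᵘ-homo-+ : ∀ p q → fromℚᵘ (p ℚᵘ.+ q) ≡ fromℚᵘ p ℚ.+ fromℚᵘ q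
fromℚᵘ-homo-+ p q = ℚ.toℚᵘ-injective (begin
  toℚᵘ (fromℚᵘ (p ℚᵘ.+ q))              ≈⟨ ℚ.toℚᵘ-fromℚᵘ (p ℚᵘ.+ q) ⟩
  p ℚᵘ.+ q                              ≈⟨ ℚᵘ.+-cong (ℚ.toℚᵘ-fromℚᵘ p) (ℚ.toℚᵘ-fromℚᵘ q) ⟨
  toℚᵘ (fromℚᵘ p) ℚᵘ.+ toℚᵘ (fromℚᵘ q)  ≈⟨ ℚ.toℚᵘ-homo-+ (fromℚᵘ p) (fromℚᵘ q) ⟨
  toℚᵘ (fromℚᵘ p ℚ.+ fromℚᵘ q)          ∎)
  where open ℚᵘ.≃-Reasoning

fromℚᵘ-homo-* : ∀ p q → fromℚᵘ (p ℚᵘ.* q) ≡ fromℚᵘ p ℚ.* fromℚᵘ q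
fromℚᵘ-homo-* p q = ℚ.toℚᵘ-injective (begin
  toℚᵘ (fromℚᵘ (p ℚᵘ.* q))              ≈⟨ ℚ.toℚᵘ-fromℚᵘ (p ℚᵘ.* q) ⟩
  p ℚᵘ.* q                              ≈⟨ ℚᵘ.*-cong (ℚ.toℚᵘ-fromℚᵘ p) (ℚ.toℚᵘ-fromℚᵘ q) ⟨
  toℚᵘ (fromℚᵘ p) ℚᵘ.* toℚᵘ (fromℚᵘ q)  ≈⟨ ℚ.toℚᵘ-homo-* (fromℚᵘ p) (fromℚᵘ q) ⟨
  toℚᵘ (fromℚᵘ p ℚ.* fromℚᵘ q)          ∎)
  where open ℚᵘ.≃-Reasoning

ι : ℕ → ℚ
ι n = + n / 1

ι-+ : ∀ m n → ι (m + n) ≡ ι m ℚ.+ ι n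
ι-+ m n = begin
  ι (m + n)                                ≡⟨ ℚ.fromℚᵘ-cong {mkℚᵘ (+ (m + n)) 0} {m′ ℚᵘ.+ n′} (*≡* eq) ⟩
  fromℚᵘ (m′ ℚᵘ.+ n′)                      ≡⟨ fromℚᵘ-homo-+ m′ n′ ⟩
  ι m ℚ.+ ι n                              ∎
  where
  open ≡-Reasoning
  m′ n′ : ℚᵘ
  m′ = mkℚᵘ (+ m) 0
  n′ = mkℚᵘ (+ n) 0
  eq : + (m + n) ℤ.* + 1 ≡ (+ m ℤ.* + 1 ℤ.+ + n ℤ.* + 1) ℤ.* + 1
  eq rewrite ℤ.*-identityʳ (+ m) | ℤ.*-identityʳ (+ n) = cong (ℤ._* + 1) (ℤ.pos-+ m n)

ι-* : ∀ m n → ι (m * n) ≡ ι m ℚ.* ι n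
ι-* m n = begin
  ι (m * n)                                ≡⟨ ℚ.fromℚᵘ-cong {mkℚᵘ (+ (m * n)) 0} {m′ ℚᵘ.* n′} (*≡* eq) ⟩
  fromℚᵘ (m′ ℚᵘ.* n′)                      ≡⟨ fromℚᵘ-homo-* m′ n′ ⟩
  ι m ℚ.* ι n                              ∎
  where
  open ≡-Reasoning
  m′ n′ : ℚᵘ
  m′ = mkℚᵘ (+ m) 0
  n′ = mkℚᵘ (+ n) 0
  eq : + (m * n) ℤ.* + 1 ≡ (+ m ℤ.* + n) ℤ.* + 1
  eq = cong (ℤ._* + 1) (ℤ.pos-* m n)

ι*/ : ∀ k m .{{_ : NonZero m}} → ι k ℚ.* (+ 1 / m) ≡ + k / m
ι*/ k m@(suc v) = begin
  ι k ℚ.* (+ 1 / m)                        ≡⟨ fromℚᵘ-homo-* k′ 1/m ⟨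
  fromℚᵘ (k′ ℚᵘ.* 1/m)                     ≡⟨ ℚ.fromℚᵘ-cong {k′ ℚᵘ.* 1/m} {mkℚᵘ (+ k) v} (*≡* eq) ⟩
  + k / m                                  ∎
  where
  open ≡-Reasoning
  k′ 1/m : ℚᵘ
  k′ = mkℚᵘ (+ k) 0
  1/m = mkℚᵘ (+ 1) v
  eq : (+ k ℤ.* + 1) ℤ.* + m ≡ + k ℤ.* + (1 * m)
  eq rewrite ℤ.*-identityʳ (+ k) | *-identityˡ m = refl

Σℚ-cong : ∀ d {f g : Fin d → ℚ} → (∀ i → f i ≡ g i) → Σℚ d f ≡ Σℚ d g
Σℚ-cong zero    f≗g = refl
Σℚ-cong (suc d) f≗g = cong₂ ℚ._+_ (f≗g zero) (Σℚ-cong d (λ i → f≗g (suc i)))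

⊗-congˡ : ∀ {d} (A : M d ℚ) {B C : M d ℚ} →
  (∀ i j → B i j ≡ C i j) → ∀ i j → (A ⊗ B) i j ≡ (A ⊗ C) i j
⊗-congˡ {d} A B≗C i j = Σℚ-cong d (λ k → cong (A i k ℚ.*_) (B≗C k j))

Triangular : ℚ → ℚ → ℚ → M 2 ℚ
Triangular x u c zero       zero       = x
Triangular x u c zero       (suc zero) = u
Triangular x u c (suc zero) zero       = 0ℚ
Triangular x u c (suc zero) (suc zero) = c

Triangular-cong : ∀ {x x′ u u′ c c′} → x ≡ x′ → u ≡ u′ → c ≡ c′ →
  ∀ i j → Triangular x u c i j ≡ Triangular x′ u′ c′ i j
Triangular-cong refl refl refl i j = refl

⊗-Triangular : ∀ x u c x′ u′ c′ i j →
  (Triangular x u c ⊗ Triangular x′ u′ c′) i j ≡ Triangular (x ℚ.* x′) (x ℚ.* u′ ℚ.+ u ℚ.* c′) (c ℚ.* c′) i j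
⊗-Triangular x u c x′ u′ c′ zero zero =
  solve 4 (λ x u x′ c′ → x :* x′ :+ (u :* con 0ℚ :+ con 0ℚ) := x :* x′) refl x u x′ c′
  where open +-*-Solver
⊗-Triangular x u c x′ u′ c′ zero (suc zero) =
  solve 4 (λ x u u′ c′ → x :* u′ :+ (u :* c′ :+ con 0ℚ) := x :* u′ :+ u :* c′) refl x u u′ c′
  where open +-*-Solver
⊗-Triangular x u c x′ u′ c′ (suc zero) zero =
  solve 2 (λ c x′ → con 0ℚ :* x′ :+ (c :* con 0ℚ :+ con 0ℚ) := con 0ℚ) refl c x′
  where open +-*-Solver
⊗-Triangular x u c x′ u′ c′ (suc zero) (suc zero) =
  solve 3 (λ c u′ c′ → con 0ℚ :* u′ :+ (c :* c′ :+ con 0ℚ) := c :* c′) refl c u′ c′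
  where open +-*-Solver

corner : ℕ → ℕ → ℕ → ℕ → ℕ
corner X U C zero    = 0
corner X U C (suc n) = X * corner X U C n + U * C ^ n

Triangular-^ : ∀ X U C r n i j →
  (Triangular (ι X) (ι U ℚ.* r) (ι C) ^ᴹ n) i j
    ≡ Triangular (ι (X ^ n)) (ι (corner X U C n) ℚ.* r) (ι (C ^ n)) i j
Triangular-^ X U C r zero zero       zero       = refl
Triangular-^ X U C r zero zero       (suc zero) = sym (ℚ.*-zeroˡ r)
Triangular-^ X U C r zero (suc zero) zero       = refl
Triangular-^ X U C r zero (suc zero) (suc zero) = refl
Triangular-^ X U C r (suc n) i j = begin
  (T ⊗ (T ^ᴹ n)) i j
    ≡⟨ ⊗-congˡ T (Triangular-^ X U C r n) i j ⟩
  (T ⊗ Triangular (ι Xⁿ) (ι N ℚ.* r) (ι Cⁿ)) i j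
    ≡⟨ ⊗-Triangular (ι X) (ι U ℚ.* r) (ι C) (ι Xⁿ) (ι N ℚ.* r) (ι Cⁿ) i j ⟩
  Triangular (ι X ℚ.* ι Xⁿ) (ι X ℚ.* (ι N ℚ.* r) ℚ.+ ι U ℚ.* r ℚ.* ι Cⁿ) (ι C ℚ.* ι Cⁿ) i j
    ≡⟨ Triangular-cong (sym (ι-* X Xⁿ)) corner-step (sym (ι-* C Cⁿ)) i j ⟩
  Triangular (ι (X ^ suc n)) (ι (corner X U C (suc n)) ℚ.* r) (ι (C ^ suc n)) i j ∎
  where
  open ≡-Reasoning
  T : M 2 ℚ
  T = Triangular (ι X) (ι U ℚ.* r) (ι C)
  Xⁿ Cⁿ N : ℕ
  Xⁿ = X ^ n
  Cⁿ = C ^ n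
  N = corner X U C n
  corner-step : ι X ℚ.* (ι N ℚ.* r) ℚ.+ ι U ℚ.* r ℚ.* ι Cⁿ ≡ ι (X * N + U * Cⁿ) ℚ.* r
  corner-step rewrite ι-+ (X * N) (U * Cⁿ) | ι-* X N | ι-* U Cⁿ =
    solve 5 (λ x n r u c → x :* (n :* r) :+ u :* r :* c := (x :* n :+ u :* c) :* r) refl
      (ι X) (ι N) r (ι U) (ι Cⁿ)
    where open +-*-Solver

IsInt-ι : ∀ k → IsInt (ι k)
IsInt-ι k = + k , refl

IsInt-/⇔∣ : ∀ k m .{{_ : NonZero m}} → IsInt (+ k / m) ⇔ m ∣ k
IsInt-/⇔∣ k m@(suc v) = mk⇔ int⇒∣ ∣⇒int
  where
  int⇒∣ : IsInt (+ k / m) → m ∣ k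
  int⇒∣ (z , k/m≡z) with ℚ./-injective-≃ (mkℚᵘ (+ k) v) (mkℚᵘ z 0) k/m≡z
  ... | *≡* k*1≡z*m = divides ℤ.∣ z ∣ (begin
    k                   ≡⟨ cong ℤ.∣_∣ (ℤ.*-identityʳ (+ k)) ⟨
    ℤ.∣ + k ℤ.* + 1 ∣   ≡⟨ cong ℤ.∣_∣ k*1≡z*m ⟩
    ℤ.∣ z ℤ.* + m ∣     ≡⟨ ℤ.abs-* z (+ m) ⟩
    ℤ.∣ z ∣ * m         ∎)
    where open ≡-Reasoning
  ∣⇒int : m ∣ k → IsInt (+ k / m)
  ∣⇒int (divides q refl) =
    + q , ℚ.fromℚᵘ-cong {mkℚᵘ (+ (q * m)) v} {mkℚᵘ (+ q) 0}
            (*≡* (trans (ℤ.*-identityʳ _) (ℤ.pos-* q m)))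

IntegralMatrix-Triangular : ∀ {x u c} → IsInt x → IsInt u → IsInt c → IntegralMatrix (Triangular x u c)
IntegralMatrix-Triangular x∈ℤ u∈ℤ c∈ℤ zero       zero       = x∈ℤ
IntegralMatrix-Triangular x∈ℤ u∈ℤ c∈ℤ zero       (suc zero) = u∈ℤ
IntegralMatrix-Triangular x∈ℤ u∈ℤ c∈ℤ (suc zero) zero       = + 0 , refl
IntegralMatrix-Triangular x∈ℤ u∈ℤ c∈ℤ (suc zero) (suc zero) = c∈ℤ

𝒮-Triangular : ∀ X U C m .{{_ : NonZero m}} n →
  𝒮 (Triangular (ι X) (ι U ℚ.* (+ 1 / m)) (ι C)) n ⇔ m ∣ corner X U C n
𝒮-Triangular X U C m n = mk⇔
  (λ Tⁿ∈ℤ → Equivalence.to N/m∈ℤ⇔m∣N (subst IsInt (power zero (suc zero)) (Tⁿ∈ℤ zero (suc zero))))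
  (λ m∣N i j → subst IsInt (sym (power i j))
     (IntegralMatrix-Triangular (IsInt-ι (X ^ n)) (Equivalence.from N/m∈ℤ⇔m∣N m∣N) (IsInt-ι (C ^ n)) i j))
  where
  N/m∈ℤ⇔m∣N : IsInt (ι (corner X U C n) ℚ.* (+ 1 / m)) ⇔ m ∣ corner X U C n
  N/m∈ℤ⇔m∣N = subst (λ q → IsInt q ⇔ m ∣ corner X U C n)
    (sym (ι*/ (corner X U C n) m)) (IsInt-/⇔∣ (corner X U C n) m)
  power : ∀ i j → (Triangular (ι X) (ι U ℚ.* (+ 1 / m)) (ι C) ^ᴹ n) i j
                ≡ Triangular (ι (X ^ n)) (ι (corner X U C n) ℚ.* (+ 1 / m)) (ι (C ^ n)) i j
  power = Triangular-^ X U C (+ 1 / m) n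

Realizable-Triangular : ∀ {S : ℕ → Set} X U C m .{{_ : NonZero m}} →
  (∀ n → S n ⇔ m ∣ corner X U C n) → Realizable S 2
Realizable-Triangular X U C m S⇔m∣N =
  Triangular (ι X) (ι U ℚ.* (+ 1 / m)) (ι C) , λ n → ⇔.trans (S⇔m∣N n) (⇔.sym (𝒮-Triangular X U C m n))

-- corner (c (1 + w)) w c (n + 1) = c^n ((1 + w)^(n + 1) - 1), with the subtraction moved across.
corner-closed-form : ∀ c w n → corner (c * suc w) w c (suc n) + c ^ n ≡ c ^ n * suc w ^ suc n
corner-closed-form c w zero    = lemma c w
  where
  lemma : ∀ c w → c * (1 + w) * 0 + w * 1 + 1 ≡ 1 * ((1 + w) * 1)
  lemma = solve-∀
corner-closed-form c w (suc n) = begin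
  X * N + w * (c * cⁿ) + c * cⁿ   ≡⟨ lemma₁ c w N cⁿ ⟩
  X * (N + cⁿ)                    ≡⟨ cong (X *_) (corner-closed-form c w n) ⟩
  X * (cⁿ * yⁿ⁺¹)                 ≡⟨ lemma₂ c w cⁿ yⁿ⁺¹ ⟩
  c * cⁿ * (suc w * yⁿ⁺¹)         ∎
  where
  open ≡-Reasoning
  X N cⁿ yⁿ⁺¹ : ℕ
  X = c * suc w
  N = corner X w c (suc n)
  cⁿ = c ^ n
  yⁿ⁺¹ = suc w ^ suc n
  lemma₁ : ∀ c w N P → c * (1 + w) * N + w * (c * P) + c * P ≡ c * (1 + w) * (N + P)
  lemma₁ = solve-∀
  lemma₂ : ∀ c w P Y → c * (1 + w) * (P * Y) ≡ c * P * ((1 + w) * Y)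
  lemma₂ = solve-∀

≡1⇒∣corner : ∀ c w {m} n → suc w ^ suc n ≡ 1 mod m → m ∣ corner (c * suc w) w c (suc n)
≡1⇒∣corner c w {m} n (≡mod t yⁿ⁺¹≡1+mt) = divides (c ^ n * t) (+-cancelʳ-≡ (c ^ n) _ _ (begin
  corner (c * suc w) w c (suc n) + c ^ n  ≡⟨ corner-closed-form c w n ⟩
  c ^ n * suc w ^ suc n                   ≡⟨ cong (c ^ n *_) yⁿ⁺¹≡1+mt ⟩
  c ^ n * (1 + m * t)                     ≡⟨ lemma (c ^ n) m t ⟩
  c ^ n * t * m + c ^ n                   ∎))
  where
  open ≡-Reasoning
  lemma : ∀ P m t → P * (1 + m * t) ≡ P * t * m + P
  lemma = solve-∀

c^n∣corner : ∀ c w n → c ^ n ∣ corner (c * suc w) w c (suc n)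
c^n∣corner c w n = ∣m+n∣m⇒∣n (subst (c ^ n ∣_) cⁿ*yⁿ⁺¹≡cⁿ+N (m∣m*n (suc w ^ suc n))) ∣-refl
  where
  cⁿ*yⁿ⁺¹≡cⁿ+N : c ^ n * suc w ^ suc n ≡ c ^ n + corner (c * suc w) w c (suc n)
  cⁿ*yⁿ⁺¹≡cⁿ+N = trans (sym (corner-closed-form c w n)) (+-comm _ (c ^ n))

c^1+n∣corner⇒≡1 : ∀ c w n .{{_ : NonZero c}} →
  c ^ suc n ∣ corner (c * suc w) w c (suc n) → suc w ^ suc n ≡ 1 mod c
c^1+n∣corner⇒≡1 c w n (divides t N≡t*c¹⁺ⁿ) = ≡mod t (*-cancelˡ-≡ _ _ (c ^ n) {{m^n≢0 c n}} (begin
  c ^ n * suc w ^ suc n                    ≡⟨ corner-closed-form c w n ⟨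
  corner (c * suc w) w c (suc n) + c ^ n   ≡⟨ cong (_+ c ^ n) N≡t*c¹⁺ⁿ ⟩
  t * (c * c ^ n) + c ^ n                  ≡⟨ lemma t c (c ^ n) ⟩
  c ^ n * (1 + c * t)                      ∎))
  where
  open ≡-Reasoning
  lemma : ∀ t c P → t * (c * P) + P ≡ P * (1 + c * t)
  lemma = solve-∀

_^ᵘ_ : ℚᵘ → ℕ → ℚᵘ
p ^ᵘ zero  = ℚᵘ.1ℚᵘ
p ^ᵘ suc n = p ℚᵘ.* p ^ᵘ n

↥-* : ∀ p q → ℚᵘ.↥ (p ℚᵘ.* q) ≡ ℚᵘ.↥ p ℤ.* ℚᵘ.↥ q
↥-* (mkℚᵘ _ _) (mkℚᵘ _ _) = refl

↧ₙ-* : ∀ p q → ℚᵘ.↧ₙ (p ℚᵘ.* q) ≡ ℚᵘ.↧ₙ p * ℚᵘ.↧ₙ q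
↧ₙ-* (mkℚᵘ _ _) (mkℚᵘ _ _) = refl

∣↥∣-^ᵘ : ∀ p n → ℤ.∣ ℚᵘ.↥ (p ^ᵘ n) ∣ ≡ ℤ.∣ ℚᵘ.↥ p ∣ ^ n
∣↥∣-^ᵘ p zero    = refl
∣↥∣-^ᵘ p (suc n) = begin
  ℤ.∣ ℚᵘ.↥ (p ℚᵘ.* p ^ᵘ n) ∣              ≡⟨ cong ℤ.∣_∣ (↥-* p (p ^ᵘ n)) ⟩
  ℤ.∣ ℚᵘ.↥ p ℤ.* ℚᵘ.↥ (p ^ᵘ n) ∣          ≡⟨ ℤ.abs-* (ℚᵘ.↥ p) (ℚᵘ.↥ (p ^ᵘ n)) ⟩
  ℤ.∣ ℚᵘ.↥ p ∣ * ℤ.∣ ℚᵘ.↥ (p ^ᵘ n) ∣    ≡⟨ cong (ℤ.∣ ℚᵘ.↥ p ∣ *_) (∣↥∣-^ᵘ p n) ⟩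
  ℤ.∣ ℚᵘ.↥ p ∣ ^ suc n                  ∎
  where open ≡-Reasoning

↧ₙ-^ᵘ : ∀ p n → ℚᵘ.↧ₙ (p ^ᵘ n) ≡ ℚᵘ.↧ₙ p ^ n
↧ₙ-^ᵘ p zero    = refl
↧ₙ-^ᵘ p (suc n) = trans (↧ₙ-* p (p ^ᵘ n)) (cong (ℚᵘ.↧ₙ p *_) (↧ₙ-^ᵘ p n))

toℚᵘ-^ᴹ : ∀ (A : M 1 ℚ) n → toℚᵘ ((A ^ᴹ n) zero zero) ℚᵘ.≃ toℚᵘ (A zero zero) ^ᵘ n
toℚᵘ-^ᴹ A zero    = ℚᵘ.≃-refl
toℚᵘ-^ᴹ A (suc n) = begin
  toℚᵘ (a ℚ.* (A ^ᴹ n) zero zero ℚ.+ 0ℚ)     ≈⟨ ℚ.toℚᵘ-cong (ℚ.+-identityʳ _) ⟩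
  toℚᵘ (a ℚ.* (A ^ᴹ n) zero zero)            ≈⟨ ℚ.toℚᵘ-homo-* a ((A ^ᴹ n) zero zero) ⟩
  toℚᵘ a ℚᵘ.* toℚᵘ ((A ^ᴹ n) zero zero)      ≈⟨ ℚᵘ.*-congˡ {toℚᵘ a} (toℚᵘ-^ᴹ A n) ⟩
  toℚᵘ a ℚᵘ.* toℚᵘ a ^ᵘ n                    ∎
  where
  open ℚᵘ.≃-Reasoning
  a : ℚ
  a = A zero zero

coprime-∣^⇒≡1 : ∀ {m d} → Coprime m d → ∀ k → d ∣ m ^ k → d ≡ 1
coprime-∣^⇒≡1 m⊥d zero    d∣1     = ∣1⇒≡1 d∣1
coprime-∣^⇒≡1 m⊥d (suc k) d∣m*mᵏ = coprime-∣^⇒≡1 m⊥d k (coprime-divisor (Coprime.sym m⊥d) d∣m*mᵏ)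

↧ₙ≡1⇒IsInt : ∀ q → ℚ.denominatorℕ q ≡ 1 → IsInt q
↧ₙ≡1⇒IsInt q ↧q≡1 = ℚ.↥ q , trans (sym (ℚ.↥p/↧p≡p q)) (ℚ./-cong {ℚ.↥ q} refl ↧q≡1)

root-IsInt : ∀ q n z → toℚᵘ q ^ᵘ suc n ℚᵘ.≃ mkℚᵘ z 0 → IsInt q
root-IsInt q@(ℚ.mkℚ p d-1 p⊥d) n z (*≡* qⁿ⁺¹*1≡z*↧) =
  ↧ₙ≡1⇒IsInt q (coprime-∣^⇒≡1 (Coprime.recompute p⊥d) (suc n) d∣∣p∣ⁿ⁺¹)
  where
  open ≡-Reasoning
  d : ℕ
  d = suc d-1
  P : ℚᵘ
  P = toℚᵘ q ^ᵘ suc n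
  ∣p∣ⁿ⁺¹≡∣z∣*dⁿ⁺¹ : ℤ.∣ p ∣ ^ suc n ≡ ℤ.∣ z ∣ * d ^ suc n
  ∣p∣ⁿ⁺¹≡∣z∣*dⁿ⁺¹ = begin
    ℤ.∣ p ∣ ^ suc n        ≡⟨ ∣↥∣-^ᵘ (toℚᵘ q) (suc n) ⟨
    ℤ.∣ ℚᵘ.↥ P ∣           ≡⟨ cong ℤ.∣_∣ (ℤ.*-identityʳ (ℚᵘ.↥ P)) ⟨
    ℤ.∣ ℚᵘ.↥ P ℤ.* + 1 ∣   ≡⟨ cong ℤ.∣_∣ qⁿ⁺¹*1≡z*↧ ⟩
    ℤ.∣ z ℤ.* ℚᵘ.↧ P ∣     ≡⟨ ℤ.abs-* z (ℚᵘ.↧ P) ⟩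
    ℤ.∣ z ∣ * ℚᵘ.↧ₙ P      ≡⟨ cong (ℤ.∣ z ∣ *_) (↧ₙ-^ᵘ (toℚᵘ q) (suc n)) ⟩
    ℤ.∣ z ∣ * d ^ suc n    ∎
  d∣∣p∣ⁿ⁺¹ : d ∣ ℤ.∣ p ∣ ^ suc n
  d∣∣p∣ⁿ⁺¹ = ∣-trans (m∣m*n (d ^ n)) (divides ℤ.∣ z ∣ ∣p∣ⁿ⁺¹≡∣z∣*dⁿ⁺¹)

𝒮-root : ∀ (A : M 1 ℚ) n → 𝒮 A (suc n) → 𝒮 A 1
𝒮-root A n Aⁿ⁺¹∈ℤ zero zero with Aⁿ⁺¹∈ℤ zero zero
... | z , Aⁿ⁺¹≡z = subst IsInt (sym A¹≡A) (root-IsInt a n z (begin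
  toℚᵘ a ^ᵘ suc n                    ≈⟨ toℚᵘ-^ᴹ A (suc n) ⟨
  toℚᵘ ((A ^ᴹ suc n) zero zero)      ≈⟨ ℚ.toℚᵘ-cong Aⁿ⁺¹≡z ⟩
  toℚᵘ (z / 1)                       ≈⟨ ℚ.toℚᵘ-fromℚᵘ (mkℚᵘ z 0) ⟩
  mkℚᵘ z 0                           ∎))
  where
  open ℚᵘ.≃-Reasoning
  a : ℚ
  a = A zero zero
  A¹≡A : (A ^ᴹ 1) zero zero ≡ a
  A¹≡A = trans (ℚ.+-identityʳ (a ℚ.* 1ℚ)) (ℚ.*-identityʳ a)

Realizable-0 : ∀ {S : ℕ → Set} → Realizable S 0 → ∀ n → S n
Realizable-0 (A , S⇔𝒮) n = Equivalence.from (S⇔𝒮 n) (λ ())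

Realizable-1-root : ∀ {S : ℕ → Set} n → Realizable S 1 → S (suc n) → S 1
Realizable-1-root n (A , S⇔𝒮) n+1∈S =
  Equivalence.from (S⇔𝒮 1) (𝒮-root A n (Equivalence.to (S⇔𝒮 (suc n)) n+1∈S))

MatDim-2 : ∀ {S : ℕ → Set} n → S (suc n) → ¬ S 1 → Realizable S 2 → MatDim S 2
MatDim-2 n n+1∈S 1∉S R₂ = R₂ , λ where
  zero          _                R₀ → 1∉S (Realizable-0 R₀ 1)
  (suc zero)    _                R₁ → 1∉S (Realizable-1-root n R₁ n+1∈S)
  (suc (suc _)) (s≤s (s≤s ()))

Cyclic⇔∣ : ∀ {a n} → Cyclic a n ⇔ a ∣ n
Cyclic⇔∣ = mk⇔ (λ (q , n≡q*a) → divides q n≡q*a) (λ (divides q n≡q*a) → q , n≡q*a)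

corner-1-1-1 : ∀ n → corner 1 1 1 n ≡ n
corner-1-1-1 zero    = refl
corner-1-1-1 (suc n) = begin
  1 * corner 1 1 1 n + 1 * 1 ^ n  ≡⟨ cong₂ _+_ (*-identityˡ _) (*-identityˡ (1 ^ n)) ⟩
  corner 1 1 1 n + 1 ^ n          ≡⟨ cong₂ _+_ (corner-1-1-1 n) (^-zeroˡ n) ⟩
  n + 1                           ≡⟨ +-comm n 1 ⟩
  suc n                           ∎
  where open ≡-Reasoning

Realizable-Cyclic : ∀ a .{{_ : NonZero a}} → Realizable (Cyclic a) 2
Realizable-Cyclic a = Realizable-Triangular 1 1 1 a λ n →
  subst (λ N → Cyclic a n ⇔ a ∣ N) (sym (corner-1-1-1 n)) Cyclic⇔∣

Realizable-resp-⇔ : ∀ {S T : ℕ → Set} {d} → (∀ n → S n ⇔ T n) → Realizable T d → Realizable S d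
Realizable-resp-⇔ S⇔T (A , T⇔𝒮) = A , λ n → ⇔.trans (S⇔T n) (T⇔𝒮 n)

Ordinary⇔Cyclic∪Ordinary : ∀ b n → Ordinary b n ⇔ (Cyclic b ∪ Ordinary b) n
Ordinary⇔Cyclic∪Ordinary b n = mk⇔ inj₂ λ where
  (inj₁ (zero  , n≡0))     → inj₁ n≡0
  (inj₁ (suc q , n≡b+q*b)) → inj₂ (subst (b ≤_) (sym n≡b+q*b) (m≤m+n b (q * b)))
  (inj₂ n∈Sb)              → n∈Sb

1∉Cyclic : ∀ {a} → 2 ≤ a → ¬ Cyclic a 1
1∉Cyclic (s≤s (s≤s _)) (zero  , ())
1∉Cyclic (s≤s (s≤s _)) (suc q , ())

1∉Ordinary : ∀ {b} → 2 ≤ b → ¬ Ordinary b 1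
1∉Ordinary _             (inj₁ ())
1∉Ordinary (s≤s (s≤s _)) (inj₂ (s≤s ()))

module Cyclic∪Ordinary (k j : ℕ) where
  a Q y : ℕ
  a = suc (suc k)
  Q = repunit a a
  y = a ^ (Q ^ j)

  a^a≡1 : a ^ a ≡ 1 mod Q
  a^a≡1 = ≡mod (suc k) (trans (^≡1+*repunit (suc k) a) (cong suc (*-comm (suc k) Q)))

  Q≡1 : Q ≡ 1 mod a
  Q≡1 = ≡mod (repunit a (suc k)) refl

  a^<Q : ∀ {r} → r < a → a ^ r < Q
  a^<Q (s≤s r≤1+k) = s≤s (≤-trans (^-monoʳ-≤ a r≤1+k) (*-monoʳ-≤ a (^≤repunit a k)))

  -- Opaque: w below is defined from the quotient of y≡a, and letting that unfold into this proof
  -- makes type checking blow up.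
  opaque
    y≡a : y ≡ a mod Q
    y≡a = subst₂ (λ u v → u ≡ v mod Q) a*[aᵃ]ᵗ≡y (*-identityʳ a)
      (≡-mod-* (≡-mod-refl {a}) (≡1-mod-^ a^a≡1 t))
      where
      open _≡_mod_ (≡1-mod-^ Q≡1 j) renaming (quotient to t; equality to Qʲ≡1+at)
      a*[aᵃ]ᵗ≡y : a * (a ^ a) ^ t ≡ y
      a*[aᵃ]ᵗ≡y = trans (cong (a *_) (^-*-assoc a a t)) (cong (a ^_) (sym Qʲ≡1+at))

  y^a≡1 : y ^ a ≡ 1 mod Q ^ suc j
  y^a≡1 = subst (λ u → u ≡ 1 mod Q ^ suc j) [aᵃ]^Qʲ≡yᵃ (lift-≡1-^ a^a≡1 j)
    where
    [aᵃ]^Qʲ≡yᵃ : (a ^ a) ^ (Q ^ j) ≡ y ^ a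
    [aᵃ]^Qʲ≡yᵃ = begin
      (a ^ a) ^ (Q ^ j)   ≡⟨ ^-*-assoc a a (Q ^ j) ⟩
      a ^ (a * Q ^ j)     ≡⟨ cong (a ^_) (*-comm a (Q ^ j)) ⟩
      a ^ (Q ^ j * a)     ≡⟨ ^-*-assoc a (Q ^ j) a ⟨
      y ^ a               ∎
      where open ≡-Reasoning

  y^n≡1⇒a∣n : ∀ {n} → y ^ n ≡ 1 mod Q → a ∣ n
  y^n≡1⇒a∣n {n} yⁿ≡1 = [ m%n≡0⇒n∣m n a , (λ ()) ]′ (m^n≡1⇒n≡0∨m≡1 a (n % a) aʳ≡1)
    where
    aʳ≡1 : a ^ (n % a) ≡ 1
    aʳ≡1 = ≡-mod-unique (≡-mod-trans (≡-mod-^ y≡a n) (^≡^% a^a≡1 n)) yⁿ≡1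
      (a^<Q (m%n<n n a)) (a^<Q z<s)

  w : ℕ
  w = suc k + Q * _≡_mod_.quotient y≡a

  y≡1+w : y ≡ suc w
  y≡1+w = _≡_mod_.equality y≡a

  N : ℕ → ℕ
  N = corner (Q * suc w) w Q

  ∈⇒∣N : ∀ n → (Cyclic a ∪ Ordinary (2 + j)) n → Q ^ suc j ∣ N n
  ∈⇒∣N zero    _                         = (Q ^ suc j) ∣0
  ∈⇒∣N (suc n) (inj₂ (inj₂ (s≤s 1+j≤n))) = ∣-trans (^-monoʳ-∣ Q 1+j≤n) (c^n∣corner Q w n)
  ∈⇒∣N (suc n) (inj₁ (t , 1+n≡t*a))      =
    ≡1⇒∣corner Q w n (subst (λ u → u ^ suc n ≡ 1 mod Q ^ suc j) y≡1+w yⁿ⁺¹≡1)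
    where
    yⁿ⁺¹≡1 : y ^ suc n ≡ 1 mod Q ^ suc j
    yⁿ⁺¹≡1 = subst (λ u → u ≡ 1 mod Q ^ suc j)
      (trans (^-*-assoc y a t) (cong (y ^_) (trans (*-comm a t) (sym 1+n≡t*a)))) (≡1-mod-^ y^a≡1 t)

  ∣N⇒∈ : ∀ n → Q ^ suc j ∣ N n → (Cyclic a ∪ Ordinary (2 + j)) n
  ∣N⇒∈ zero    _ = inj₂ (inj₁ refl)
  ∣N⇒∈ (suc n) Q¹⁺ʲ∣N with suc j ≤? n
  ... | yes 1+j≤n = inj₂ (inj₂ (s≤s 1+j≤n))
  ... | no  1+j≰n = inj₁ (Equivalence.from Cyclic⇔∣ a∣1+n)
    where
    Q¹⁺ⁿ∣N : Q ^ suc n ∣ N (suc n)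
    Q¹⁺ⁿ∣N = ∣-trans (^-monoʳ-∣ Q (≰⇒> 1+j≰n)) Q¹⁺ʲ∣N
    a∣1+n : a ∣ suc n
    a∣1+n = y^n≡1⇒a∣n (subst (λ u → u ^ suc n ≡ 1 mod Q) (sym y≡1+w)
      (c^1+n∣corner⇒≡1 Q w n Q¹⁺ⁿ∣N))

  realizable : Realizable (Cyclic a ∪ Ordinary (2 + j)) 2
  realizable = Realizable-Triangular (Q * suc w) w Q (Q ^ suc j) {{m^n≢0 Q (suc j)}}
    λ n → mk⇔ (∈⇒∣N n) (∣N⇒∈ n)

theorem2p8 : ((a : ℕ) → 2 ≤ a → MatDim (Cyclic a) 2)
    × ((b : ℕ) → 2 ≤ b → MatDim (Ordinary b) 2)
    × ((a b : ℕ) → 2 ≤ a → 2 ≤ b → MatDim (Cyclic a ∪ Ordinary b) 2)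
theorem2p8 = cyclic , ordinary , union
  where
  cyclic : (a : ℕ) → 2 ≤ a → MatDim (Cyclic a) 2
  cyclic a@(suc (suc k)) 2≤a@(s≤s (s≤s _)) =
    MatDim-2 (suc k) (1 , sym (+-identityʳ a)) (1∉Cyclic 2≤a) (Realizable-Cyclic a)

  union : (a b : ℕ) → 2 ≤ a → 2 ≤ b → MatDim (Cyclic a ∪ Ordinary b) 2
  union (suc (suc k)) (suc (suc j)) 2≤a@(s≤s (s≤s _)) 2≤b@(s≤s (s≤s _)) =
    MatDim-2 (suc j) (inj₂ (inj₂ ≤-refl)) [ 1∉Cyclic 2≤a , 1∉Ordinary 2≤b ]′
      (Cyclic∪Ordinary.realizable k j)

  ordinary : (b : ℕ) → 2 ≤ b → MatDim (Ordinary b) 2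
  ordinary b@(suc (suc j)) 2≤b@(s≤s (s≤s _)) =
    MatDim-2 (suc j) (inj₂ ≤-refl) (1∉Ordinary 2≤b)
      (Realizable-resp-⇔ (Ordinary⇔Cyclic∪Ordinary b) (Cyclic∪Ordinary.realizable j j))
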